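{- If every node $\pi$ of the generating tree $\mathcal T_b$ is replaced by the pair $(i,j)$, where $i$ is the number of left-to-right maxima and $j$ the number of right-to-left maxima of $\pi$, one obtains exactly the labelled plane tree $\mathcal T$. In particular $\mathcal T_b$ is isomorphic to $\mathcal T$.
   Context: A Baxter permutation is $\pi\in\mathfrak S_n$ with no $i<j<k$ such that $\pi(j+1)<\pi(i)<\pi(k)<\pi(j)$ or $\pi(j)<\pi(k)<\pi(i)<\pi(j+1)$; $\mathcal B_n$ denotes the set of them. For $\sigma\in\mathcal B_n$ with $i$ left-to-right maxima and $j$ right-to-left maxima, let $L_k(\sigma)$ ($1\le k\le i$) be obtained by inserting the value $n+1$ immediately before the $k$-th left-to-right maximum of $\sigma$ (counted from the left), and $R_k(\sigma)$ ($1\le k\le j$) by inserting $n+1$ immediately after the $k$-th right-to-left maximum (counted from the right, so the first one is $\sigma(n)$). These are exactly the elements of $\mathcal B_{n+1}$ whose deletion of the entry $n+1$ gives $\sigma$. $\mathcal T_b$ is the rooted plane tree with root the permutation $1$, in which the children of $\sigma$ are, from left to right, $L_1(\sigma),\dots,L_i(\sigma),R_j(\sigma),\dots,R_1(\sigma)$. $\mathcal T$ is the rooted plane labelled tree with root label $(1,1)$ in which a node labelled $(i,j)$ has children labelled, from left to right, $(1,j+1),(2,j+1),\dots,(i,j+1),(i+1,j),\dots,(i+1,2),(i+1,1)$. -}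

module Defs where

open import Data.Nat using (ℕ; zero; suc; _∸_; _<ᵇ_)
open import Data.Bool using (if_then_else_)
open import Data.List using (List; []; _∷_; _++_; map; length; reverse; upTo)
open import Data.Product using (_×_; _,_)

-- Permutations of [n] in one-line notation: σ = [σ(1), …, σ(n)] with values in 1..n.
Perm : Set
Perm = List ℕ

-- 0-based positions of the left-to-right maxima, in increasing order (left to right).
lrmaxFrom : ℕ → ℕ → List ℕ → List ℕ
lrmaxFrom m i []       = []
lrmaxFrom m i (x ∷ xs) =
  if m <ᵇ x then i ∷ lrmaxFrom x (suc i) xs else lrmaxFrom m (suc i) xs

lrmaxPos : Perm → List ℕ
lrmaxPos σ = lrmaxFrom 0 0 σ

-- 0-based positions of the right-to-left maxima, counted from the right
-- (so the first one is the position n-1 of σ(n)).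
rlmaxPos : Perm → List ℕ
rlmaxPos σ = map (λ q → length σ ∸ 1 ∸ q) (lrmaxPos (reverse σ))

lrmax rlmax : Perm → ℕ
lrmax σ = length (lrmaxPos σ)
rlmax σ = length (rlmaxPos σ)

insertAt : ℕ → ℕ → List ℕ → List ℕ
insertAt zero    v xs       = v ∷ xs
insertAt (suc p) v []       = v ∷ []
insertAt (suc p) v (x ∷ xs) = x ∷ insertAt p v xs

-- L_k(σ): insert n+1 immediately before the k-th left-to-right maximum.
Lchildren : Perm → List Perm
Lchildren σ = map (λ p → insertAt p (suc (length σ)) σ) (lrmaxPos σ)

-- R_k(σ): insert n+1 immediately after the k-th right-to-left maximum (from the right).
Rchildren : Perm → List Perm
Rchildren σ = map (λ p → insertAt (suc p) (suc (length σ)) σ) (rlmaxPos σ)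

baxterChildren : Perm → List Perm
baxterChildren σ = Lchildren σ ++ reverse (Rchildren σ)

labelChildren : ℕ × ℕ → List (ℕ × ℕ)
labelChildren (i , j) =
  map (λ k → (suc k , suc j)) (upTo i) ++ reverse (map (λ k → (suc i , suc k)) (upTo j))

data Tree (A : Set) : Set where
  node : A → List (Tree A) → Tree A

unfoldTree : {A B : Set} → ℕ → (A → List A) → (A → B) → A → Tree B
unfoldTree zero    ch lab x = node (lab x) []
unfoldTree (suc d) ch lab x = node (lab x) (map (unfoldTree d ch lab) (ch x))

TbLabelled : ℕ → Tree (ℕ × ℕ)
TbLabelled d = unfoldTree d baxterChildren (λ π → (lrmax π , rlmax π)) (1 ∷ [])

Tlab : ℕ → Tree (ℕ × ℕ)
Tlab d = unfoldTree d labelChildren (λ x → x) (1 , 1)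

module Submission where

-- Since both trees are unfolded from a root by a child rule, it suffices to show
-- that the labelling commutes with the child rules (`unfoldTree-relabel`), i.e.
-- that the labels of L_1(σ), …, L_i(σ), R_j(σ), …, R_1(σ) are
-- (1,j+1), …, (i,j+1), (i+1,j), …, (i+1,1) whenever σ has label (i,j).
-- The only property of σ used is that n+1 exceeds all its entries (`Bounded`).
--
-- Inserting a new maximum B immediately before a left-to-right maximum (a
-- "record position") of a list xs has two effects:
--   * before the k-th record it leaves exactly k records (`records-after-insertions`);
--   * it adds exactly one right-to-left maximum, B itself, since everything
--     behind the record position is dominated by that record
--     (`records-reverse-insertion`).
-- This gives the labels of the L-children; the R-children of σ are the mirror
-- images of the L-children of reverse σ (`reverse-insertAt`), and reversal swaps
-- the two coordinates of a label (`label-reverse`).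

open import Defs
open import Data.Nat using (ℕ; zero; suc; _∸_; _<ᵇ_; _<_; _≤_; _⊔_; _+_; _<?_; z≤n; s≤s; z<s)
open import Data.Nat.Properties
open import Data.Bool using (true; false)
open import Data.List using (List; []; _∷_; _++_; map; length; reverse; upTo; take; drop; [_])
open import Data.List.Properties
  using ( map-++; length-map; map-∘; map-cong; map-cong-local; length-++; length-take; length-drop
        ; reverse-++; unfold-reverse; length-reverse; reverse-map; reverse-involutive
        ; take++drop≡id; ++-assoc; map-upTo)
open import Data.List.Relation.Unary.All as All using (All; []; _∷_)
open import Data.List.Relation.Unary.All.Properties using (map⁺; ++⁺; ++⁻ˡ; ++⁻ʳ)
open import Data.List.Relation.Unary.Any using (here; there)
import Data.List.Relation.Unary.Any.Properties as Any
open import Data.List.Membership.Propositional using (_∈_)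
open import Data.Product using (_×_; _,_; proj₁; proj₂; swap)
open import Function using (_∘_; id)
open import Relation.Binary.PropositionalEquality hiding ([_])
open import Relation.Nullary using (yes; no; contradiction)

open ≡-Reasoning

<ᵇ-true : ∀ {m n} → m < n → (m <ᵇ n) ≡ true
<ᵇ-true {m} {n} m<n with m <ᵇ n | <⇒<ᵇ m<n
... | true | _ = refl

<ᵇ-false : ∀ {m n} → n ≤ m → (m <ᵇ n) ≡ false
<ᵇ-false {m} {n} n≤m with m <ᵇ n | <ᵇ⇒< m n
... | false | _ = refl
... | true  | m<n = contradiction (m<n _) (≤⇒≯ n≤m)

all-reverse : ∀ {A : Set} {P : A → Set} {xs : List A} → All P xs → All P (reverse xs)
all-reverse ps = All.tabulate (λ x∈ → All.lookup ps (Any.reverse⁻ x∈))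

lrmaxFrom-suc : ∀ m i xs → lrmaxFrom m (suc i) xs ≡ map suc (lrmaxFrom m i xs)
lrmaxFrom-suc m i [] = refl
lrmaxFrom-suc m i (x ∷ xs) with m <ᵇ x
... | true  = cong (suc i ∷_) (lrmaxFrom-suc x (suc i) xs)
... | false = lrmaxFrom-suc m (suc i) xs

lrmaxFrom-above : ∀ {m x} i xs → m < x → lrmaxFrom m i (x ∷ xs) ≡ i ∷ map suc (lrmaxFrom x i xs)
lrmaxFrom-above {m} {x} i xs m<x rewrite <ᵇ-true m<x = cong (i ∷_) (lrmaxFrom-suc x i xs)

lrmaxFrom-below : ∀ {m x} i xs → x ≤ m → lrmaxFrom m i (x ∷ xs) ≡ map suc (lrmaxFrom m i xs)
lrmaxFrom-below {m} {x} i xs x≤m rewrite <ᵇ-false x≤m = lrmaxFrom-suc m i xs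

records : ℕ → List ℕ → ℕ
records m xs = length (lrmaxFrom m 0 xs)

records-above : ∀ {m x} xs → m < x → records m (x ∷ xs) ≡ suc (records x xs)
records-above {x = x} xs m<x =
  trans (cong length (lrmaxFrom-above 0 xs m<x)) (cong suc (length-map suc (lrmaxFrom x 0 xs)))

records-below : ∀ {m x} xs → x ≤ m → records m (x ∷ xs) ≡ records m xs
records-below {m} xs x≤m =
  trans (cong length (lrmaxFrom-below 0 xs x≤m)) (length-map suc (lrmaxFrom m 0 xs))

records-dominated : ∀ {m zs} → All (_≤ m) zs → records m zs ≡ 0
records-dominated {zs = []} [] = refl
records-dominated {zs = z ∷ zs} (z≤m ∷ zs≤m) = trans (records-below zs z≤m) (records-dominated zs≤m)

records-fresh-max : ∀ {m B zs} → m < B → All (_≤ B) zs → records m (B ∷ zs) ≡ 1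
records-fresh-max {zs = zs} m<B zs≤B = trans (records-above zs m<B) (cong suc (records-dominated zs≤B))

maxL : List ℕ → ℕ
maxL []       = 0
maxL (x ∷ xs) = x ⊔ maxL xs

∈⇒≤maxL : ∀ {x xs} → x ∈ xs → x ≤ maxL xs
∈⇒≤maxL {xs = y ∷ ys} (here refl) = m≤m⊔n y (maxL ys)
∈⇒≤maxL {xs = y ∷ ys} (there x∈) = ≤-trans (∈⇒≤maxL x∈) (m≤n⊔m y (maxL ys))

⊔maxL-< : ∀ {k B} xs → k < B → All (_< B) xs → k ⊔ maxL xs < B
⊔maxL-< {k} [] k<B [] = subst (_< _) (sym (⊔-identityʳ k)) k<B
⊔maxL-< {k} (x ∷ xs) k<B (x<B ∷ xs<B) =
  ⊔-lub k<B (⊔maxL-< xs x<B xs<B)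

records-++ : ∀ m ys zs → records m (ys ++ zs) ≡ records m ys + records (m ⊔ maxL ys) zs
records-++ m [] zs = cong (λ k → records k zs) (sym (⊔-identityʳ m))
records-++ m (y ∷ ys) zs with m <? y
... | yes m<y = begin
    records m (y ∷ ys ++ zs)                        ≡⟨ records-above (ys ++ zs) m<y ⟩
    suc (records y (ys ++ zs))                      ≡⟨ cong suc (records-++ y ys zs) ⟩
    suc (records y ys + records (y ⊔ maxL ys) zs)   ≡⟨ cong₂ (λ a t → a + records t zs)
                                                         (sym (records-above ys m<y)) absorbed ⟩
    records m (y ∷ ys) + records (m ⊔ (y ⊔ maxL ys)) zs ∎
  where
  absorbed : y ⊔ maxL ys ≡ m ⊔ (y ⊔ maxL ys)
  absorbed = trans (cong (_⊔ maxL ys) (sym (m≤n⇒m⊔n≡n (<⇒≤ m<y)))) (⊔-assoc m y (maxL ys))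
... | no m≮y = begin
    records m (y ∷ ys ++ zs)                        ≡⟨ records-below (ys ++ zs) y≤m ⟩
    records m (ys ++ zs)                            ≡⟨ records-++ m ys zs ⟩
    records m ys + records (m ⊔ maxL ys) zs         ≡⟨ cong₂ (λ a t → a + records t zs)
                                                         (sym (records-below ys y≤m)) absorbed ⟩
    records m (y ∷ ys) + records (m ⊔ (y ⊔ maxL ys)) zs ∎
  where
  y≤m = ≮⇒≥ m≮y
  absorbed : m ⊔ maxL ys ≡ m ⊔ (y ⊔ maxL ys)
  absorbed = trans (cong (_⊔ maxL ys) (sym (m≥n⇒m⊔n≡m y≤m))) (⊔-assoc m y (maxL ys))

records-++-dominated : ∀ m ys zs → All (_≤ m ⊔ maxL ys) zs → records m (ys ++ zs) ≡ records m ys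
records-++-dominated m ys zs zs≤ =
  trans (records-++ m ys zs) (trans (cong (records m ys +_) (records-dominated zs≤)) (+-identityʳ _))

insertAt-++ : ∀ (v : ℕ) ys zs → insertAt (length ys) v (ys ++ zs) ≡ ys ++ v ∷ zs
insertAt-++ v []       zs = refl
insertAt-++ v (y ∷ ys) zs = cong (y ∷_) (insertAt-++ v ys zs)

reverse-++-∷ : ∀ (v : ℕ) ys zs → reverse (ys ++ v ∷ zs) ≡ reverse zs ++ v ∷ reverse ys
reverse-++-∷ v ys zs = begin
  reverse (ys ++ v ∷ zs)             ≡⟨ reverse-++ ys (v ∷ zs) ⟩
  reverse (v ∷ zs) ++ reverse ys     ≡⟨ cong (_++ reverse ys) (unfold-reverse v zs) ⟩
  (reverse zs ++ [ v ]) ++ reverse ys ≡⟨ ++-assoc (reverse zs) [ v ] (reverse ys) ⟩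
  reverse zs ++ v ∷ reverse ys       ∎

reverse-insertAt : ∀ (v : ℕ) xs q → q ≤ length xs →
                   reverse (insertAt (length xs ∸ q) v xs) ≡ insertAt q v (reverse xs)
reverse-insertAt v xs q q≤n = begin
    reverse (insertAt k v xs)
  ≡⟨ cong₂ (λ p l → reverse (insertAt p v l)) (sym |ys|≡k) (sym (take++drop≡id k xs)) ⟩
    reverse (insertAt (length ys) v (ys ++ zs))
  ≡⟨ cong reverse (insertAt-++ v ys zs) ⟩
    reverse (ys ++ v ∷ zs)
  ≡⟨ reverse-++-∷ v ys zs ⟩
    reverse zs ++ v ∷ reverse ys
  ≡⟨ sym (insertAt-++ v (reverse zs) (reverse ys)) ⟩
    insertAt (length (reverse zs)) v (reverse zs ++ reverse ys)
  ≡⟨ cong₂ (λ p l → insertAt p v l) (trans (length-reverse zs) |zs|≡q) (sym (reverse-++ ys zs)) ⟩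
    insertAt q v (reverse (ys ++ zs))
  ≡⟨ cong (insertAt q v ∘ reverse) (take++drop≡id k xs) ⟩
    insertAt q v (reverse xs) ∎
  where
  k = length xs ∸ q
  ys = take k xs
  zs = drop k xs
  |ys|≡k : length ys ≡ k
  |ys|≡k = trans (length-take k xs) (m≤n⇒m⊓n≡m (m∸n≤m (length xs) q))
  |zs|≡q : length zs ≡ q
  |zs|≡q = trans (length-drop k xs) (m∸[m∸n]≡n q≤n)

record RecordAt (m : ℕ) (xs : List ℕ) (q : ℕ) : Set where
  constructor recordAt
  field
    before    : List ℕ
    entry     : ℕ
    after     : List ℕ
    split     : xs ≡ before ++ entry ∷ after
    position  : length before ≡ q
    exceeds   : m < entry
    dominates : All (_< entry) before

recordAt-∷ : ∀ {m m' x xs q} → m ≤ m' → x ≤ m' → RecordAt m' xs q → RecordAt m (x ∷ xs) (suc q)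
recordAt-∷ {x = x} m≤m' x≤m' (recordAt t h r s p e d) =
  recordAt (x ∷ t) h r (cong (x ∷_) s) (cong suc p) (≤-<-trans m≤m' e) (≤-<-trans x≤m' e ∷ d)

recordAt-< : ∀ {m xs q} → RecordAt m xs q → q < length xs
recordAt-< (recordAt t h r refl refl _ _) =
  subst (length t <_) (sym (length-++ t)) (m<m+n (length t) z<s)

lrmax-records : ∀ m xs → All (RecordAt m xs) (lrmaxFrom m 0 xs)
lrmax-records m [] = []
lrmax-records m (x ∷ xs) with m <? x
... | yes m<x = subst (All (RecordAt m (x ∷ xs))) (sym (lrmaxFrom-above 0 xs m<x))
      (recordAt [] x xs refl refl m<x [] ∷ map⁺ (All.map (recordAt-∷ (<⇒≤ m<x) ≤-refl) (lrmax-records x xs)))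
... | no m≮x = subst (All (RecordAt m (x ∷ xs))) (sym (lrmaxFrom-below 0 xs (≮⇒≥ m≮x)))
      (map⁺ (All.map (recordAt-∷ ≤-refl (≮⇒≥ m≮x)) (lrmax-records m xs)))

-- Inserting a new maximum B before the k-th record leaves exactly k records:
-- the records in front of it, and B.
records-after-insertions : ∀ {B} m xs → m < B → All (_< B) xs →
  map (λ q → records m (insertAt q B xs)) (lrmaxFrom m 0 xs) ≡ map suc (upTo (records m xs))
records-after-insertions m [] m<B [] = refl
records-after-insertions {B} m (x ∷ xs) m<B (x<B ∷ xs<B) with m <? x
... | yes m<x = begin
    map F (lrmaxFrom m 0 (x ∷ xs))
  ≡⟨ cong (map F) (lrmaxFrom-above 0 xs m<x) ⟩
    F 0 ∷ map F (map suc P)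
  ≡⟨ cong₂ _∷_ (records-fresh-max m<B (All.map <⇒≤ (x<B ∷ xs<B))) (sym (map-∘ P)) ⟩
    1 ∷ map (λ q → records m (x ∷ insertAt q B xs)) P
  ≡⟨ cong (1 ∷_) (map-cong (λ q → records-above (insertAt q B xs) m<x) P) ⟩
    1 ∷ map (suc ∘ G) P
  ≡⟨ cong (1 ∷_) (map-∘ P) ⟩
    1 ∷ map suc (map G P)
  ≡⟨ cong (λ l → 1 ∷ map suc l) (records-after-insertions x xs x<B xs<B) ⟩
    1 ∷ map suc (map suc (upTo (records x xs)))
  ≡⟨ cong (λ l → 1 ∷ map suc l) (map-upTo suc (records x xs)) ⟩
    map suc (upTo (suc (records x xs)))
  ≡⟨ cong (map suc ∘ upTo) (sym (records-above xs m<x)) ⟩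
    map suc (upTo (records m (x ∷ xs))) ∎
  where
  F = λ q → records m (insertAt q B (x ∷ xs))
  G = λ q → records x (insertAt q B xs)
  P = lrmaxFrom x 0 xs
... | no m≮x = begin
    map F (lrmaxFrom m 0 (x ∷ xs))
  ≡⟨ cong (map F) (lrmaxFrom-below 0 xs x≤m) ⟩
    map F (map suc P)
  ≡⟨ sym (map-∘ P) ⟩
    map (λ q → records m (x ∷ insertAt q B xs)) P
  ≡⟨ map-cong (λ q → records-below (insertAt q B xs) x≤m) P ⟩
    map (λ q → records m (insertAt q B xs)) P
  ≡⟨ records-after-insertions m xs m<B xs<B ⟩
    map suc (upTo (records m xs))
  ≡⟨ cong (map suc ∘ upTo) (sym (records-below xs x≤m)) ⟩
    map suc (upTo (records m (x ∷ xs))) ∎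
  where
  F = λ q → records m (insertAt q B (x ∷ xs))
  P = lrmaxFrom m 0 xs
  x≤m = ≮⇒≥ m≮x

-- Inserting a new maximum B at a record position adds exactly one right-to-left
-- maximum: read from the right, B beats everything behind the record, and the
-- entries in front of the record are all dominated by it.
records-reverse-insertion : ∀ {B m xs q} k → k < B → All (_< B) xs → RecordAt m xs q →
  records k (reverse (insertAt q B xs)) ≡ suc (records k (reverse xs))
records-reverse-insertion {B} k k<B xs<B (recordAt t h r refl refl _ t<h) = begin
    records k (reverse (insertAt (length t) B (t ++ h ∷ r)))
  ≡⟨ cong (records k ∘ reverse) (insertAt-++ B t (h ∷ r)) ⟩
    records k (reverse (t ++ B ∷ h ∷ r))
  ≡⟨ cong (records k) (reverse-++-∷ B t (h ∷ r)) ⟩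
    records k (D ++ B ∷ T)
  ≡⟨ records-++ k D (B ∷ T) ⟩
    records k D + records M (B ∷ T)
  ≡⟨ cong (records k D +_) (records-fresh-max M<B T≤B) ⟩
    records k D + 1
  ≡⟨ +-comm (records k D) 1 ⟩
    suc (records k D)
  ≡⟨ cong suc (sym (records-++-dominated k D T T≤M)) ⟩
    suc (records k (D ++ T))
  ≡⟨ cong (suc ∘ records k) (sym (reverse-++ t (h ∷ r))) ⟩
    suc (records k (reverse (t ++ h ∷ r))) ∎
  where
  D = reverse (h ∷ r)
  T = reverse t
  M = k ⊔ maxL D
  M<B : M < B
  M<B = ⊔maxL-< D k<B (all-reverse (++⁻ʳ t xs<B))
  T≤B : All (_≤ B) T
  T≤B = all-reverse (All.map <⇒≤ (++⁻ˡ t xs<B))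
  h≤M : h ≤ M
  h≤M = ≤-trans (∈⇒≤maxL (Any.reverse⁺ {xs = h ∷ r} (here refl))) (m≤n⊔m k (maxL D))
  T≤M : All (_≤ M) T
  T≤M = all-reverse (All.map (λ y<h → ≤-trans (<⇒≤ y<h) h≤M) t<h)

label : Perm → ℕ × ℕ
label π = (lrmax π , rlmax π)

rlmax-records : ∀ π → rlmax π ≡ records 0 (reverse π)
rlmax-records π = length-map (λ q → length π ∸ 1 ∸ q) (lrmaxFrom 0 0 (reverse π))

label-reverse : ∀ π → label (reverse π) ≡ swap (label π)
label-reverse π = cong₂ _,_ (sym (rlmax-records π))
  (trans (rlmax-records (reverse π)) (cong (records 0) (reverse-involutive π)))

labels-of-record-insertions : ∀ {b} xs → All (_< suc b) xs →
  map (λ q → label (insertAt q (suc b) xs)) (lrmaxPos xs)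
    ≡ map (λ k → (suc k , suc (rlmax xs))) (upTo (lrmax xs))
labels-of-record-insertions {b} xs xs<B = begin
    map (λ q → label (τ q)) P
  ≡⟨ map-cong-local (All.map new-rlmax (lrmax-records 0 xs)) ⟩
    map (λ q → (lrmax (τ q) , suc (rlmax xs))) P
  ≡⟨ map-∘ P ⟩
    map (_, suc (rlmax xs)) (map (lrmax ∘ τ) P)
  ≡⟨ cong (map (_, suc (rlmax xs))) (records-after-insertions 0 xs z<s xs<B) ⟩
    map (_, suc (rlmax xs)) (map suc (upTo (lrmax xs)))
  ≡⟨ sym (map-∘ (upTo (lrmax xs))) ⟩
    map (λ k → (suc k , suc (rlmax xs))) (upTo (lrmax xs)) ∎
  where
  P = lrmaxPos xs
  τ = λ q → insertAt q (suc b) xs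
  new-rlmax : ∀ {q} → RecordAt 0 xs q → label (τ q) ≡ (lrmax (τ q) , suc (rlmax xs))
  new-rlmax {q} rec = cong (lrmax (τ q) ,_) (begin
    rlmax (τ q)                  ≡⟨ rlmax-records (τ q) ⟩
    records 0 (reverse (τ q))    ≡⟨ records-reverse-insertion 0 z<s xs<B rec ⟩
    suc (records 0 (reverse xs)) ≡⟨ cong suc (sym (rlmax-records xs)) ⟩
    suc (rlmax xs)               ∎)

-- The invariant of 𝒯_b that makes n+1 a new maximum.
Bounded : Perm → Set
Bounded σ = All (_< suc (length σ)) σ

labels-Lchildren : ∀ σ → Bounded σ →
  map label (Lchildren σ) ≡ map (λ k → (suc k , suc (rlmax σ))) (upTo (lrmax σ))
labels-Lchildren σ bσ = trans (sym (map-∘ (lrmaxPos σ))) (labels-of-record-insertions σ bσ)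

-- R_k inserts after position n-1-q, i.e. at position n-q.
suc-∸-pred : ∀ {n q} → q < n → suc (n ∸ 1 ∸ q) ≡ n ∸ q
suc-∸-pred {suc n} (s≤s q≤n) = sym (+-∸-assoc 1 q≤n)

-- R_k(σ) is the mirror image of L_k(reverse σ), so its label is the swapped one.
labels-Rchildren : ∀ σ → Bounded σ →
  map label (Rchildren σ) ≡ map (λ k → (suc (lrmax σ) , suc k)) (upTo (rlmax σ))
labels-Rchildren σ bσ = begin
    map label (map (λ p → insertAt (suc p) B σ) (map mirror Q))
  ≡⟨ sym (map-∘ (map mirror Q)) ⟩
    map (λ p → label (insertAt (suc p) B σ)) (map mirror Q)
  ≡⟨ sym (map-∘ Q) ⟩
    map (λ q → label (insertAt (suc (mirror q)) B σ)) Q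
  ≡⟨ map-cong-local (All.map mirrored (lrmax-records 0 σ')) ⟩
    map (swap ∘ λ q → label (insertAt q B σ')) Q
  ≡⟨ map-∘ Q ⟩
    map swap (map (λ q → label (insertAt q B σ')) Q)
  ≡⟨ cong (map swap) (labels-of-record-insertions σ' (all-reverse bσ)) ⟩
    map swap (map (λ k → (suc k , suc (rlmax σ'))) (upTo (lrmax σ')))
  ≡⟨ sym (map-∘ (upTo (lrmax σ'))) ⟩
    map (λ k → (suc (rlmax σ') , suc k)) (upTo (lrmax σ'))
  ≡⟨ cong₂ (λ i j → map (λ k → (suc i , suc k)) (upTo j))
       (cong proj₂ (label-reverse σ)) (cong proj₁ (label-reverse σ)) ⟩
    map (λ k → (suc (lrmax σ) , suc k)) (upTo (rlmax σ)) ∎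
  where
  B = suc (length σ)
  σ' = reverse σ
  Q = lrmaxPos σ'
  mirror = λ q → length σ ∸ 1 ∸ q
  mirrored : ∀ {q} → RecordAt 0 σ' q → label (insertAt (suc (mirror q)) B σ) ≡ swap (label (insertAt q B σ'))
  mirrored {q} rec = begin
      label τ                          ≡⟨ cong label (sym (reverse-involutive τ)) ⟩
      label (reverse (reverse τ))      ≡⟨ label-reverse (reverse τ) ⟩
      swap (label (reverse τ))         ≡⟨ cong (swap ∘ label) reverse-τ ⟩
      swap (label (insertAt q B σ'))   ∎
    where
    τ = insertAt (suc (mirror q)) B σ
    q<n : q < length σ
    q<n = subst (q <_) (length-reverse σ) (recordAt-< rec)
    reverse-τ : reverse τ ≡ insertAt q B σ'
    reverse-τ = trans (cong (λ p → reverse (insertAt p B σ)) (suc-∸-pred q<n))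
                      (reverse-insertAt B σ q (<⇒≤ q<n))

labels-children : ∀ σ → Bounded σ → map label (baxterChildren σ) ≡ labelChildren (label σ)
labels-children σ bσ = begin
    map label (Lchildren σ ++ reverse (Rchildren σ))
  ≡⟨ map-++ label (Lchildren σ) (reverse (Rchildren σ)) ⟩
    map label (Lchildren σ) ++ map label (reverse (Rchildren σ))
  ≡⟨ cong₂ _++_ (labels-Lchildren σ bσ)
       (trans (reverse-map label (Rchildren σ)) (cong reverse (labels-Rchildren σ bσ))) ⟩
    labelChildren (label σ) ∎

length-insertAt : ∀ p (v : ℕ) xs → length (insertAt p v xs) ≡ suc (length xs)
length-insertAt zero    v xs       = refl
length-insertAt (suc p) v []       = refl
length-insertAt (suc p) v (x ∷ xs) = cong suc (length-insertAt p v xs)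

all-insertAt : ∀ {P : ℕ → Set} p {v} xs → P v → All P xs → All P (insertAt p v xs)
all-insertAt zero    xs       pv ps       = pv ∷ ps
all-insertAt (suc p) []       pv []       = pv ∷ []
all-insertAt (suc p) (x ∷ xs) pv (px ∷ ps) = px ∷ all-insertAt p xs pv ps

bounded-insertAt : ∀ p σ → Bounded σ → Bounded (insertAt p (suc (length σ)) σ)
bounded-insertAt p σ bσ rewrite length-insertAt p (suc (length σ)) σ =
  all-insertAt p σ (n<1+n (suc (length σ))) (All.map m<n⇒m<1+n bσ)

bounded-children : ∀ {σ} → Bounded σ → All Bounded (baxterChildren σ)
bounded-children {σ} bσ =
  ++⁺ (map⁺ (All.universal (λ p → bounded-insertAt p σ bσ) (lrmaxPos σ)))
      (all-reverse (map⁺ (All.universal (λ p → bounded-insertAt (suc p) σ bσ) (rlmaxPos σ))))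

module _ {A C : Set} (P : A → Set) (chA : A → List A) (chC : C → List C) (f : A → C)
         (preserved : ∀ {a} → P a → All P (chA a))
         (commutes : ∀ {a} → P a → map f (chA a) ≡ chC (f a)) where

  unfoldTree-relabel : ∀ d {a} → P a → unfoldTree d chA f a ≡ unfoldTree d chC id (f a)
  unfoldTree-relabel zero    pa = refl
  unfoldTree-relabel (suc d) {a} pa = cong (node (f a)) (begin
      map (unfoldTree d chA f) (chA a)
    ≡⟨ map-cong-local (All.map (unfoldTree-relabel d) (preserved pa)) ⟩
      map (unfoldTree d chC id ∘ f) (chA a)
    ≡⟨ map-∘ (chA a) ⟩
      map (unfoldTree d chC id) (map f (chA a))
    ≡⟨ cong (map (unfoldTree d chC id)) (commutes pa) ⟩
      map (unfoldTree d chC id) (chC (f a)) ∎)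

-- Proposition 4.1: the root 1 is bounded and has label (1,1).
proposition4p1 : (d : ℕ) → TbLabelled d ≡ Tlab d
proposition4p1 d =
  unfoldTree-relabel Bounded baxterChildren labelChildren label
    bounded-children (λ {σ} → labels-children σ) d (s≤s (s≤s z≤n) ∷ [])
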